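{- For integers $s\geq 1$ and $d\geq 0$, if $t=(ds+1)s^s$, then the complete bipartite graph $K_{s,t}$ is not $s$-choosable with defect $d$.
   Context: A $k$-list assignment $L$ for a graph $G$ assigns a set $L(v)$ of at least $k$ colours to each vertex $v$. $G$ is $k$-choosable with defect $d$ if for every $k$-list assignment $L$ there is a colouring assigning each vertex $v$ a colour in $L(v)$ such that every vertex has at most $d$ neighbours of its own colour. -}

module Defs where

open import Data.Nat using (ℕ; _+_; _*_; _^_; _≤_; _<ᵇ_)
open import Data.Nat.Properties using (_≟_)
open import Data.Bool using (Bool; true; false; _xor_; T)
open import Data.Fin using (Fin; toℕ)
open import Data.List using (List; length; filter; allFin)
open import Data.List.Membership.Propositional using (_∈_)
open import Data.List.Relation.Unary.Unique.Propositional using (Unique)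
open import Data.Product using (Σ; _×_)
open import Relation.Nullary using (Dec; yes; no; ¬_)
open import Relation.Binary.PropositionalEquality using (_≡_)
open import Relation.Nullary.Decidable using (_×-dec_; ⌊_⌋)
open import Relation.Unary using (Decidable)

record Graph (n : ℕ) : Set where
  field
    adj   : Fin n → Fin n → Bool
    sym   : ∀ u v → adj u v ≡ adj v u
    irrefl : ∀ v → adj v v ≡ false
open Graph public

record ListAssignment {n : ℕ} (k : ℕ) : Set where
  field
    list    : Fin n → List ℕ
    unique  : ∀ v → Unique (list v)
    size    : ∀ v → k ≤ length (list v)
open ListAssignment public

sameColourNbrs : ∀ {n} → Graph n → (Fin n → ℕ) → Fin n → ℕ
sameColourNbrs {n} G c v =
  length (filter (λ u → T? (adj G v u) ×-dec (c u ≟ c v)) (allFin n))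
  where
    T? : (b : Bool) → Dec (T b)
    T? true  = yes _
    T? false = no (λ ())

IsDefectiveLColouring : ∀ {n k} → Graph n → ListAssignment {n} k → ℕ → (Fin n → ℕ) → Set
IsDefectiveLColouring G L d c =
  (∀ v → c v ∈ list L v) × (∀ v → sameColourNbrs G c v ≤ d)

Choosable : ∀ {n} → Graph n → ℕ → ℕ → Set
Choosable {n} G k d =
  (L : ListAssignment {n} k) → Σ (Fin n → ℕ) (IsDefectiveLColouring G L d)

-- complete bipartite graph K_{s,t} on Fin (s + t):
-- vertices with index < s form one side, the rest the other side.
K : (s t : ℕ) → Graph (s + t)
K s t = record
  { adj = λ u v → (toℕ u <ᵇ s) xor (toℕ v <ᵇ s)
  ; sym = λ u v → xor-comm (toℕ u <ᵇ s) (toℕ v <ᵇ s)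
  ; irrefl = λ v → xor-self (toℕ v <ᵇ s)
  }
  where
    xor-comm : ∀ a b → (a xor b) ≡ (b xor a)
    xor-comm true true = _≡_.refl
    xor-comm true false = _≡_.refl
    xor-comm false true = _≡_.refl
    xor-comm false false = _≡_.refl
    xor-self : ∀ a → (a xor a) ≡ false
    xor-self true = _≡_.refl
    xor-self false = _≡_.refl

module Submission where

-- Colours code pairs (j , e) of elements of [s] = Fin s: "colour e of block j".
-- Write t = D·N with D = ds+1 and N = sˢ, so that a vertex of the large side is
-- a pair (k , q) with k ∈ [D] and q ∈ [N] the code of a function f_q : [s] → [s].
-- Vertex i of the small side receives the whole block i, and vertex (k , q) of
-- the large side receives the transversal {(j , f_q j) : j ∈ [s]}.  In a colouring
-- from these lists the small side chooses a colour (j , f j) in every block j;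
-- for the code q of this f, each of the D vertices (k , q) then has the colour of
-- one of the s small-side vertices, all of which it is adjacent to.  A union
-- bound turns these D same-coloured neighbours into D ≤ s·d, a contradiction.
--
-- The argument never
-- uses s ≥ 1 (for s = 0 the lists are empty and no colouring exists).

open import Defs hiding (sym)
open import Data.Nat using (ℕ; zero; suc; z≤n; s≤s; _+_; _*_; _^_; _≥_; _≤_; _<_; z<s)
open import Data.Nat.Properties
  using (_≟_; ≤-refl; ≤-trans; ≤-reflexive; n≤1+n; +-mono-≤; +-suc; *-comm; m≤m+n; m<m+n; <⇒≱; ≮⇒≥; <⇒<ᵇ; <ᵇ⇒<)
open import Data.Bool using (true; false; T; _xor_)
open import Data.Bool.Properties using (T?)
open import Data.Unit using (tt)
open import Data.Fin using (Fin; toℕ; _↑ˡ_; _↑ʳ_; splitAt; combine; remainder; funToFin; finToFun)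
  renaming (zero to fzero; suc to fsuc)
open import Data.Fin.Properties
  using (any?; pigeonhole; toℕ<n; toℕ-↑ˡ; toℕ-↑ʳ; toℕ-injective; ↑ʳ-injective; splitAt-↑ˡ; splitAt-↑ʳ;
         remQuot-combine; combine-injectiveˡ; combine-injectiveʳ; finToFun-funToFin)
  renaming (<⇒≢ to <⇒≢ᶠ)
open import Data.List using (List; []; _∷_; length; filter; allFin; tabulate; lookup)
open import Data.List.Properties using (length-tabulate; filter-none; filter-≐)
open import Data.List.Membership.Propositional using (_∈_)
open import Data.List.Membership.Propositional.Properties using (∈-filter⁺; ∈-allFin; ∈-tabulate⁻)
open import Data.List.Relation.Unary.All using (universal)
open import Data.List.Relation.Unary.Any using (index)
open import Data.List.Relation.Unary.Any.Properties using (lookup-index)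
import Data.List.Relation.Unary.Unique.Propositional.Properties as Unique
open import Data.Product using (Σ; _×_; _,_; proj₁; proj₂; ∃)
open import Data.Sum using (_⊎_; inj₁; inj₂)
open import Function using (_∘_; id)
open import Relation.Nullary using (¬_; yes; no; contradiction)
open import Relation.Nullary.Decidable using (_×-dec_)
open import Relation.Unary using (Decidable)
open import Relation.Binary.PropositionalEquality using (_≡_; sym; trans; cong; cong-app; module ≡-Reasoning)

module Counting {A : Set} where

  count : {P : A → Set} → Decidable P → List A → ℕ
  count P? xs = length (filter P? xs)

  count-∷-≤ : {P : A → Set} (P? : Decidable P) (x : A) (xs : List A) →
    count P? xs ≤ count P? (x ∷ xs)
  count-∷-≤ P? x xs with P? x
  ... | yes _ = n≤1+n _
  ... | no _  = ≤-refl

  count-∷-< : {P : A → Set} (P? : Decidable P) {x : A} (xs : List A) → P x →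
    count P? xs < count P? (x ∷ xs)
  count-∷-< P? {x} xs px with P? x
  ... | yes _  = ≤-refl
  ... | no ¬px = contradiction px ¬px

  count-∪ : {Q P R : A → Set} (Q? : Decidable Q) (P? : Decidable P) (R? : Decidable R) →
    (∀ x → Q x → P x ⊎ R x) → ∀ xs → count Q? xs ≤ count P? xs + count R? xs
  count-∪ Q? P? R? cover [] = z≤n
  count-∪ Q? P? R? cover (x ∷ xs) with Q? x
  ... | no _ = ≤-trans (count-∪ Q? P? R? cover xs)
                 (+-mono-≤ (count-∷-≤ P? x xs) (count-∷-≤ R? x xs))
  ... | yes qx with cover x qx
  ...   | inj₁ px = ≤-trans (s≤s (count-∪ Q? P? R? cover xs))
                      (+-mono-≤ (count-∷-< P? xs px) (count-∷-≤ R? x xs))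
  ...   | inj₂ rx = ≤-trans (s≤s (count-∪ Q? P? R? cover xs))
                      (≤-trans (≤-reflexive (sym (+-suc (count P? xs) (count R? xs))))
                        (+-mono-≤ (count-∷-≤ P? x xs) (count-∷-< R? xs rx)))

  count-⋃ : ∀ {k d} {Q : A → Set} (Q? : Decidable Q) (P : Fin k → A → Set)
    (P? : ∀ j → Decidable (P j)) → (∀ x → Q x → ∃ λ j → P j x) →
    ∀ xs → (∀ j → count (P? j) xs ≤ d) → count Q? xs ≤ k * d
  count-⋃ {zero} {Q = Q} Q? P P? cover xs bound =
    ≤-reflexive (cong length (filter-none Q? (universal nowhere xs)))
    where
    nowhere : ∀ x → ¬ Q x
    nowhere x qx with cover x qx
    ... | () , _
  count-⋃ {suc k} {Q = Q} Q? P P? cover xs bound =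
    ≤-trans (count-∪ Q? (P? fzero) rest? split xs)
            (+-mono-≤ (bound fzero) (count-⋃ rest? (P ∘ fsuc) (P? ∘ fsuc) (λ _ → id) xs (bound ∘ fsuc)))
    where
    rest? : Decidable (λ x → ∃ λ j → P (fsuc j) x)
    rest? x = any? (λ j → P? (fsuc j) x)
    split : ∀ x → Q x → P fzero x ⊎ (∃ λ j → P (fsuc j) x)
    split x qx with cover x qx
    ... | fzero , p = inj₁ p
    ... | fsuc j , p = inj₂ (j , p)

open Counting

count-injection : ∀ {n k} {Q : Fin n → Set} (Q? : Decidable Q) (e : Fin k → Fin n) →
  (∀ {i j} → e i ≡ e j → i ≡ j) → (∀ i → Q (e i)) → k ≤ count Q? (allFin n)
count-injection {n} {k} Q? e e-injective Qe = ≮⇒≥ too-few-impossible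
  where
  xs : List (Fin n)
  xs = filter Q? (allFin n)
  member : ∀ i → e i ∈ xs
  member i = ∈-filter⁺ Q? (∈-allFin (e i)) (Qe i)
  -- two distinct i, j at the same position of xs would have e i ≡ e j
  too-few-impossible : ¬ (length xs < k)
  too-few-impossible xs<k with pigeonhole xs<k (index ∘ member)
  ... | i , j , i<j , same-position = <⇒≢ᶠ i<j (e-injective (begin
      e i                          ≡⟨ lookup-index (member i) ⟩
      lookup xs (index (member i)) ≡⟨ cong (lookup xs) same-position ⟩
      lookup xs (index (member j)) ≡⟨ lookup-index (member j) ⟨
      e j                          ∎))
    where open ≡-Reasoning

tabulatedAssignment : ∀ {n k} (g : Fin n → Fin k → ℕ) →
  (∀ v {x y} → g v x ≡ g v y → x ≡ y) → ListAssignment {n} k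
tabulatedAssignment g g-injective = record
  { list   = λ v → tabulate (g v)
  ; unique = λ v → Unique.tabulate⁺ (g-injective v)
  ; size   = λ v → ≤-reflexive (sym (length-tabulate (g v)))
  }

SameColourNbr : ∀ {n} → Graph n → (Fin n → ℕ) → Fin n → Fin n → Set
SameColourNbr G c v u = T (adj G v u) × c u ≡ c v

sameColourNbr? : ∀ {n} (G : Graph n) (c : Fin n → ℕ) (v : Fin n) → Decidable (SameColourNbr G c v)
sameColourNbr? G c v u = T? (adj G v u) ×-dec (c u ≟ c v)

sameColourNbrs-count : ∀ {n} (G : Graph n) (c : Fin n → ℕ) (v : Fin n) →
  count (sameColourNbr? G c v) (allFin n) ≡ sameColourNbrs G c v
sameColourNbrs-count {n} G c v =
  cong length (filter-≐ (sameColourNbr? G c v) _ (id , id) (allFin n))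

K-adjacent : ∀ s t (i : Fin s) (w : Fin t) → T (adj (K s t) (i ↑ˡ t) (s ↑ʳ w))
K-adjacent s t i w rewrite toℕ-↑ˡ i t | toℕ-↑ʳ s w =
  xor-true-false (<⇒<ᵇ (toℕ<n i)) (λ s+w<s → <⇒≱ (<ᵇ⇒< _ s s+w<s) (m≤m+n s (toℕ w)))
  where
  xor-true-false : ∀ {a b} → T a → ¬ T b → T (a xor b)
  xor-true-false {true} {true}  _ ¬b = ¬b tt
  xor-true-false {true} {false} _ _  = tt

module Construction (s d : ℕ) where

  N D t : ℕ
  N = s ^ s
  D = d * s + 1
  t = D * N

  colour : Fin s → Fin s → ℕ
  colour j e = toℕ (combine j e)

  offer : Fin s ⊎ Fin t → Fin s → ℕ
  offer (inj₁ i) e = colour i e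
  offer (inj₂ w) j = colour j (finToFun (remainder {D} N w) j)

  offer-injective : ∀ x {e e′} → offer x e ≡ offer x e′ → e ≡ e′
  offer-injective (inj₁ i) {e} {e′} same = combine-injectiveʳ i e i e′ (toℕ-injective same)
  offer-injective (inj₂ _) {j} {j′} same = combine-injectiveˡ j _ j′ _ (toℕ-injective same)

  L : ListAssignment {s + t} s
  L = tabulatedAssignment (offer ∘ splitAt s) (λ v → offer-injective (splitAt s v))

  small : Fin s → Fin (s + t)
  small i = i ↑ˡ t

  large : Fin N → Fin D → Fin (s + t)
  large q k = s ↑ʳ combine k q

  offer-small : ∀ i → offer (splitAt s (small i)) ≡ colour i
  offer-small i = cong offer (splitAt-↑ˡ s i t)

  offer-large : ∀ q k j → offer (splitAt s (large q k)) j ≡ colour j (finToFun q j)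
  offer-large q k j = begin
    offer (splitAt s (s ↑ʳ combine k q)) j
      ≡⟨ cong (λ x → offer x j) (splitAt-↑ʳ s t (combine k q)) ⟩
    colour j (finToFun (remainder {D} N (combine k q)) j)
      ≡⟨ cong (λ r → colour j (finToFun (proj₂ r) j)) (remQuot-combine k q) ⟩
    colour j (finToFun q j)
      ∎
    where open ≡-Reasoning

  large-injective : ∀ q {k k′} → large q k ≡ large q k′ → k ≡ k′
  large-injective q {k} {k′} same = combine-injectiveˡ k q k′ q (↑ʳ-injective s _ _ same)

  -- In an L-colouring, let f j be the offset of the colour of small j in block j
  -- and q the code of f: every vertex large q k is a same-coloured neighbour of
  -- some small-side vertex.
  forced-conflicts : ∀ c → (∀ v → c v ∈ list L v) →
    Σ (Fin N) λ q → ∀ k → ∃ λ j → SameColourNbr (K s t) c (small j) (large q k)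
  forced-conflicts c from-lists = funToFin offset , conflict
    where
    offset-spec : ∀ j → ∃ λ e → c (small j) ≡ colour j e
    offset-spec j with ∈-tabulate⁻ (from-lists (small j))
    ... | e , in-block = e , trans in-block (cong-app (offer-small j) e)
    offset : Fin s → Fin s
    offset j = proj₁ (offset-spec j)
    conflict : ∀ k → ∃ λ j → SameColourNbr (K s t) c (small j) (large (funToFin offset) k)
    conflict k with ∈-tabulate⁻ (from-lists (large (funToFin offset) k))
    ... | j , in-transversal = j , K-adjacent s t j _ , (begin
      c (large q k)                  ≡⟨ in-transversal ⟩
      offer (splitAt s (large q k)) j ≡⟨ offer-large q k j ⟩
      colour j (finToFun q j)        ≡⟨ cong (colour j) (finToFun-funToFin offset j) ⟩
      colour j (offset j)            ≡⟨ proj₂ (offset-spec j) ⟨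
      c (small j)                    ∎)
      where
      q : Fin N
      q = funToFin offset
      open ≡-Reasoning

  -- no L-colouring has defect d: the D conflicting vertices would give D ≤ s·d
  no-colouring : ∀ c → ¬ IsDefectiveLColouring (K s t) L d c
  no-colouring c (from-lists , defect) = <⇒≱ (m<m+n (d * s) z<s) D≤d*s
    where
    q : Fin N
    q = proj₁ (forced-conflicts c from-lists)
    conflict : ∀ k → ∃ λ j → SameColourNbr (K s t) c (small j) (large q k)
    conflict = proj₂ (forced-conflicts c from-lists)
    Conflicting : Fin (s + t) → Set
    Conflicting u = ∃ λ j → SameColourNbr (K s t) c (small j) u
    conflicting? : Decidable Conflicting
    conflicting? u = any? (λ j → sameColourNbr? (K s t) c (small j) u)
    at-least : D ≤ count conflicting? (allFin (s + t))
    at-least = count-injection conflicting? (large q) (large-injective q) conflict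
    at-most : count conflicting? (allFin (s + t)) ≤ s * d
    at-most = count-⋃ conflicting? _ (λ j → sameColourNbr? (K s t) c (small j)) (λ _ → id)
      (allFin (s + t)) (λ j → ≤-trans (≤-reflexive (sameColourNbrs-count (K s t) c (small j))) (defect (small j)))
    D≤d*s : D ≤ d * s
    D≤d*s = ≤-trans at-least (≤-trans at-most (≤-reflexive (*-comm s d)))

mainTheorem9 : (s d : ℕ) → s ≥ 1 → ¬ Choosable (K s ((d * s + 1) * s ^ s)) s d
mainTheorem9 s d _ choosable = no-colouring (proj₁ colouring) (proj₂ colouring)
  where
  open Construction s d
  colouring : Σ (Fin (s + t) → ℕ) (IsDefectiveLColouring (K s t) L d)
  colouring = choosable L
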